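{- Fix $n$ and $p$ with $0\le p\le n/2$, and let $q>0$ be such that $\Delta_k(q)\ne 0$ for $0\le k\le n$. For every half-diagram $\mathfrak{a}$ on $n$ points with $p$ pairs, the element $\xi'_{\mathfrak{a}}\in U(n)$ is a linear combination of the elements $\xi_{\mathfrak{b}}$ with $\mathfrak{b}\preceq\mathfrak{a}$ (where $\mathfrak{b}$ ranges over half-diagrams on $n$ points with $p$ pairs).
   Context: Temperley–Lieb algebra: $TL_n$ is the complex vector space with basis $e_{\mathfrak{p}}$ indexed by noncrossing pairings $\mathfrak{p}$ of $\{1,\dots,2n\}$, drawn with points $1,\dots,n$ top to bottom on the left of a rectangle and $n+1,\dots,2n$ bottom to top on the right. The generator $e_i$ ($1\le i\le n-1$) pairs $i$ with $i+1$, $2n-i+1$ with $2n-i$, and every other $j\le n$ with $2n-j+1$. Half-diagrams: a half-diagram on $n$ points is a noncrossing partition of $\{1,\dots,n\}$ into pairs and singletons (singletons carry through-strings; noncrossing means no $i<k<j<l$ with $i\sim j,k\sim l$ and no $i<k<j$ with $i\sim j$, $k$ a singleton). $U(n)$ has basis $\xi_{\mathfrak{a}}$ over half-diagrams. $TL_n$ acts on $U(n)$: for a pairing $\mathfrak{p}$ and half-diagram $\mathfrak{a}$, identify point $i$ of $\mathfrak{a}$ with point $2n-i+1$ of $\mathfrak{p}$; if an edge path joins two through-strings of $\mathfrak{a}$ the result is $0$; otherwise $e_{\mathfrak{p}}\xi_{\mathfrak{a}}=q^c\xi_{\mathfrak{b}}$ where $c$ is the number of closed loops and $\mathfrak{b}$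 is the half-diagram induced on points $1,\dots,n$ of $\mathfrak{p}$ by following edge paths (a point joined to a through-string of $\mathfrak{a}$ carries a through-string). Heights: $h_0(\mathfrak{a})=0$, $h_i(\mathfrak{a})$ = #$\{j\le i$: $j$ a through-string or paired with a larger point$\}$ − #$\{j\le i$: $j$ paired with a smaller point$\}$; a half-diagram is determined by its heights. Partial order on half-diagrams with the same number of pairs: $\mathfrak{b}\preceq\mathfrak{a}$ iff $h_i(\mathfrak{b})\le h_i(\mathfrak{a})$ for all $i$. $\mathfrak{a}$ has a minimum at $i$ ($1\le i\le n-1$) if $h_{i-1}(\mathfrak{a})>h_i(\mathfrak{a})<h_{i+1}(\mathfrak{a})$; then $\Diamond_i(\mathfrak{a})$ is the half-diagram with the same heights except $h_i$ increased by $2$. Chebyshev polynomials: $\Delta_{ -1}=0$, $\Delta_0=1$, $\Delta_{k+1}(q)=q\Delta_k(q)-\Delta_{k-1}(q)$; $\mu_k=\Delta_{k-1}(q)/\Delta_k(q)$. Second basis: the minimal element $(1,\dots,1)$ with $p$ pairs is the half-diagram with pairs $\{1,2\},\{3,4\},\dots,\{2p-1,2p\}$ and through-strings at $2p+1,\dots,n$; every half-diagram with $p$ pairs arises from it by a finite sequence of box additions. Set $\xi'_{(1,\dots,1)}=\xi_{(1,\dots,1)}$ and, whenever $\mathfrak{a}$ has a minimum at $i$, $\xi'_{\Diamond_i(\mathfrak{a})}=(e_i-\mu_{h_i(\mathfrak{a})+1})\xi'_{\mathfrak{a}}$ (this is independent of the chosen sequence of box additions). -}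

module Defs where

open import Level using (Level; _⊔_)
open import Algebra.Bundles using (CommutativeRing)
open import Data.Nat as ℕ using (ℕ; zero; suc)
open import Data.Integer as ℤ using (ℤ; +_; ∣_∣)
open import Data.Fin as Fin using (Fin; toℕ; fromℕ<; _≟_)
open import Data.Fin.Properties using (all?)
open import Data.Nat.Properties using (<⇒≤; ≤-refl; <-trans; n<1+n)
open import Data.Nat.DivMod using (_%_)
open import Data.Maybe using (Maybe; just; nothing)
open import Data.Maybe.Properties using (≡-dec)
open import Data.Product using (_×_; _,_; ∃; Σ)
open import Data.List using (List; []; _∷_; _++_; map)
open import Data.List.Relation.Unary.All using (All)
open import Data.Empty using (⊥)
open import Relation.Nullary using (¬_; yes; no)
import Relation.Nullary
open import Relation.Binary.PropositionalEquality using (_≡_; _≢_)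

-- Half-diagrams on n points (points 0..n-1 here = 1..n in the paper).
-- A "raw" diagram assigns to each point its partner (just j) or
-- nothing (the point carries a through-string / is a singleton).

Raw : ℕ → Set
Raw n = Fin n → Maybe (Fin n)

record IsHalfDiagram {n : ℕ} (a : Raw n) : Set where
  field
    symmetric    : ∀ i j → a i ≡ just j → a j ≡ just i
    irreflexive  : ∀ i → a i ≢ just i
    noncrossing  : ∀ i j k l → a i ≡ just j → a k ≡ just l →
                   i Fin.< k → k Fin.< j → j Fin.< l → ⊥
    noEnclosedThrough : ∀ i j k → a i ≡ just j → a k ≡ nothing →
                   i Fin.< k → k Fin.< j → ⊥

step : ∀ {n} → Raw n → Fin n → ℤ
step a j with a j
... | nothing = + 1
... | just k with toℕ j ℕ.<? toℕ k
...   | yes _ = + 1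
...   | no  _ = ℤ.- (+ 1)

-- h i a = h_i(a) : contributions of the first i points (paper's 1..i)
h : ∀ {n} → Raw n → ℕ → ℤ
h {n} a zero = + 0
h {n} a (suc i) with i ℕ.<? n
... | yes i<n = h a i ℤ.+ step a (fromℕ< i<n)
... | no  _   = h a i

-- number of pairs = number of points paired with a smaller point
closers : ∀ {n} → Raw n → (m : ℕ) → m ℕ.≤ n → ℕ
closers a zero _ = 0
closers {n} a (suc m) m<n with a (fromℕ< m<n)
... | nothing = closers a m (<⇒≤ m<n)
... | just k with toℕ k ℕ.<? m
...   | yes _ = suc (closers a m (<⇒≤ m<n))
...   | no  _ = closers a m (<⇒≤ m<n)

pairs : ∀ {n} → Raw n → ℕ
pairs {n} a = closers a n ≤-refl

_⪯_ : ∀ {n} → Raw n → Raw n → Set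
_⪯_ {n} b a = pairs b ≡ pairs a × (∀ i → i ℕ.≤ n → h b i ℤ.≤ h a i)

-- a has a minimum at paper-index i (1 ≤ i ≤ n-1)
HasMinAt : ∀ {n} → Raw n → ℕ → Set
HasMinAt a i = (h a (i ℕ.∸ 1) ℤ.> h a i) × (h a i ℤ.< h a (suc i))

IsDiamond : ∀ {n} → ℕ → Raw n → Raw n → Set
IsDiamond {n} i a b =
  (∀ j → j ℕ.≤ n → j ≢ i → h b j ≡ h a j) × (h b i ≡ h a i ℤ.+ + 2)

-- minimal element (1,…,1) with p pairs: {1,2},{3,4},…,{2p-1,2p},
-- through-strings at 2p+1..n   (0-based here: {0,1},{2,3},…)
minDiag : ∀ {n} → ℕ → Raw n
minDiag {n} p j with toℕ j ℕ.<? 2 ℕ.* p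
... | no _ = nothing
... | yes _ = toFin partner
  where
  partner : ℕ
  partner with toℕ j % 2 ℕ.≟ 0
  ... | yes _ = suc (toℕ j)
  ... | no  _ = toℕ j ℕ.∸ 1
  toFin : ℕ → Maybe (Fin n)
  toFin m with m ℕ.<? n
  ... | yes m<n = just (fromℕ< m<n)
  ... | no  _   = nothing

-- Action of the generator e_i on a half-diagram, following edge paths
-- in the glued picture.  x = point i, y = point i+1 (paper indices).
-- Result: nothing  (the element is 0: two through-strings joined), or
-- just (c , b) meaning e_i ξ_a = q^c ξ_b.

data Outcome (n : ℕ) : Set where
  zeroV : Outcome n
  term  : ℕ → Raw n → Outcome n

glue : ∀ {n} → Fin n → Fin n → Raw n → Raw n
glue x y a j with j ≟ x | j ≟ y
... | yes _ | _     = just y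
... | no _  | yes _ = just x
... | no _  | no _ with a j
...   | nothing = nothing
...   | just z with z ≟ x | z ≟ y
...     | yes _ | _     = a y
...     | no _  | yes _ = a x
...     | no _  | no _  = just z

actGen : ∀ {n} → Fin n → Fin n → Raw n → Outcome n
actGen x y a with a x | a y
... | nothing | nothing = zeroV
... | just z  | _ with z ≟ y
...   | yes _ = term 1 a
...   | no  _ = term 0 (glue x y a)
actGen x y a | nothing | just _ = term 0 (glue x y a)

_≟R_ : ∀ {n} (a b : Raw n) → Relation.Nullary.Dec (∀ i → a i ≡ b i)
a ≟R b = all? (λ i → ≡-dec _≟_ (a i) (b i))

-- Coefficients: a commutative ring R (in the paper: ℂ), a parameter q.

module _ {c ℓ} (R : CommutativeRing c ℓ) where
  open CommutativeRing R

  -- Δ' k = Δ_{k-1}(q):  Δ' 0 = Δ_{-1} = 0, Δ' 1 = Δ_0 = 1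
  Δ' : Carrier → ℕ → Carrier
  Δ' q zero = 0#
  Δ' q (suc zero) = 1#
  Δ' q (suc (suc k)) = q * Δ' q (suc k) - Δ' q k

  Δ : Carrier → ℕ → Carrier
  Δ q k = Δ' q (suc k)

  -- μ_k = Δ_{k-1}(q) / Δ_k(q), given a chosen inverse inv k of Δ_k(q)
  μ : Carrier → (ℕ → Carrier) → ℕ → Carrier
  μ q inv k = Δ' q k * inv k

  q^ : Carrier → ℕ → Carrier
  q^ q zero = 1#
  q^ q (suc m) = q * q^ q m

  -- elements of U(n): formal finite linear combinations Σ c ξ_a
  U : ℕ → Set c
  U n = List (Carrier × Raw n)

  coeff : ∀ {n} → U n → Raw n → Carrier
  coeff [] b = 0#
  coeff ((k , a) ∷ v) b with a ≟R b
  ... | yes _ = k + coeff v b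
  ... | no  _ = coeff v b

  _≋_ : ∀ {n} → U n → U n → Set ℓ
  v ≋ w = ∀ b → coeff v b ≈ coeff w b

  actU : ∀ {n} → Carrier → Fin n → Fin n → U n → U n
  actU q x y [] = []
  actU q x y ((k , a) ∷ v) with actGen x y a
  ... | zeroV = actU q x y v
  ... | term m b = (k * q^ q m , b) ∷ actU q x y v

  scale : ∀ {n} → Carrier → U n → U n
  scale s v = map (λ { (k , a) → (s * k , a) }) v

  boxOp : ∀ {n} → Carrier → (ℕ → Carrier) → Fin n → Fin n → ℕ → U n → U n
  boxOp q inv x y m v = actU q x y v ++ scale (- μ q inv m) v

  -- Reach q inv n p a v : v is ξ'_a, obtained from ξ_(1,…,1) (p pairs)
  -- by SOME sequence of box additions (any such sequence).
  -- A box addition at paper-index suc i acts on points i+1, i+2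
  -- (0-based: i, suc i) and has μ index h_{i+1}(a) + 1.
  data Reach (q : Carrier) (inv : ℕ → Carrier) (n p : ℕ) :
             Raw n → U n → Set (c ⊔ ℓ) where
    start : Reach q inv n p (minDiag p) ((1# , minDiag p) ∷ [])
    box   : ∀ {a v} (i : ℕ) (si<n : suc i ℕ.< n) (b : Raw n) →
            Reach q inv n p a v →
            HasMinAt a (suc i) →
            IsHalfDiagram b →
            IsDiamond (suc i) a b →
            Reach q inv n p b
              (boxOp q inv (fromℕ< (<-trans (n<1+n i) si<n))
                           (fromℕ< si<n)
                           (suc ∣ h a (suc i) ∣) v)

  InSpanBelow : ∀ {n} → ℕ → Raw n → U n → Set (c ⊔ ℓ)
  InSpanBelow p a v =
    Σ (U _) λ L →
      All (λ { (k , b) → IsHalfDiagram b × pairs b ≡ p × b ⪯ a }) L × (v ≋ L)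

module Submission where

-- ξ'_a is represented by the list v of terms produced by its box additions,
-- and this list itself is the required combination: every basis vector ξ_c
-- occurring in it is a half-diagram with p pairs and c ⪯ a.  For a box addition
-- b = ◇_{i+1}(a) at a minimum, the terms of (e_{i+1} − μ)v are the terms of
-- v, lying below a ⪯ b, and the terms of e_{i+1} ξ_c: either ξ_c itself (a
-- closed loop) or a glued diagram g.  The main work is g ⪯ b: g is again a
-- half-diagram, and its step sequence arises from that of c by a swap of an
-- up- and a down-step, which lowers all heights except possibly h_{i+1};
-- there h_{i+1}(g) = h_i(g) + 1 ≤ h_i(a) + 1 = h_{i+1}(b).  Equal final
-- heights give equal numbers of pairs.

open import Defs
open import Algebra.Bundles using (CommutativeRing)
open import Data.Nat using (ℕ; _≤_; _*_)
open import Data.Product using (_,_; proj₂)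

open import Data.Nat using (zero; suc; _<_; _+_; _∸_)
import Data.Nat as ℕ
import Data.Nat.Properties as ℕP
open import Data.Nat.DivMod using (_%_; m*n%n≡0; [m+kn]%n≡m%n)
open import Data.Integer as ℤ using (ℤ; +_; -1ℤ)
import Data.Integer.Properties as ℤP
open import Data.Integer.Tactic.RingSolver using (solve-∀)
open import Algebra.Properties.AbelianGroup ℤP.+-0-abelianGroup using (∙-cancelʳ)
open import Data.Fin as Fin using (Fin; toℕ; fromℕ<; _≟_)
import Data.Fin.Properties as FinP
open import Data.Maybe using (Maybe; just; nothing)
open import Data.Maybe.Properties using (just-injective)
open import Data.Empty using (⊥; ⊥-elim)
open import Data.Sum using (_⊎_; inj₁; inj₂)
open import Data.Product using (_×_; proj₁)
open import Data.List using ([]; _∷_)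
open import Data.List.Relation.Unary.All as All using (All; []; _∷_)
open import Data.List.Relation.Unary.All.Properties using (++⁺)
open import Relation.Nullary using (¬_; yes; no)
open import Relation.Binary using (tri<; tri≈; tri>)
open import Relation.Binary.PropositionalEquality
open import Function using (case_of_)

nothing≢just : ∀ {A : Set} {x : A} → nothing ≢ just x
nothing≢just ()

stepOf : ∀ {n} → Fin n → Maybe (Fin n) → ℤ
stepOf u nothing = + 1
stepOf u (just k) with toℕ u ℕ.<? toℕ k
... | yes _ = + 1
... | no  _ = -1ℤ

step≡stepOf : ∀ {n} (a : Raw n) u → step a u ≡ stepOf u (a u)
step≡stepOf a u with a u
... | nothing = refl
... | just k with toℕ u ℕ.<? toℕ k
...   | yes _ = refl
...   | no _ = refl

step-cong : ∀ {n} (a b : Raw n) u → a u ≡ b u → step a u ≡ step b u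
step-cong a b u e = trans (step≡stepOf a u) (trans (cong (stepOf u) e) (sym (step≡stepOf b u)))

step-through : ∀ {n} (a : Raw n) u → a u ≡ nothing → step a u ≡ + 1
step-through a u e = trans (step≡stepOf a u) (cong (stepOf u) e)

step-opener : ∀ {n} (a : Raw n) u {k} → a u ≡ just k → toℕ u < toℕ k → step a u ≡ + 1
step-opener a u {k} e u<k = trans (step≡stepOf a u) (trans (cong (stepOf u) e) up)
  where
  up : stepOf u (just k) ≡ + 1
  up with toℕ u ℕ.<? toℕ k
  ... | yes _ = refl
  ... | no u≮k = ⊥-elim (u≮k u<k)

step-closer : ∀ {n} (a : Raw n) u {k} → a u ≡ just k → toℕ k < toℕ u → step a u ≡ -1ℤ
step-closer a u {k} e k<u = trans (step≡stepOf a u) (trans (cong (stepOf u) e) down)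
  where
  down : stepOf u (just k) ≡ -1ℤ
  down with toℕ u ℕ.<? toℕ k
  ... | yes u<k = ⊥-elim (ℕP.<-asym u<k k<u)
  ... | no _ = refl

step-±1 : ∀ {n} (a : Raw n) u → step a u ≡ + 1 ⊎ step a u ≡ -1ℤ
step-±1 a u = sign (a u) (step≡stepOf a u)
  where
  sign : ∀ m → step a u ≡ stepOf u m → step a u ≡ + 1 ⊎ step a u ≡ -1ℤ
  sign nothing e = inj₁ e
  sign (just k) e with toℕ u ℕ.<? toℕ k
  ... | yes _ = inj₁ e
  ... | no _ = inj₂ e

height-suc : ∀ {n} (a : Raw n) m (m<n : m < n) → h a (suc m) ≡ h a m ℤ.+ step a (fromℕ< m<n)
height-suc {n} a m m<n with m ℕ.<? n
... | yes _ = refl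
... | no m≮n = ⊥-elim (m≮n m<n)

heights-cong : ∀ {n} (a b : Raw n) → (∀ u → step a u ≡ step b u) → ∀ j → h a j ≡ h b j
heights-cong a b e zero = refl
heights-cong {n} a b e (suc j) with j ℕ.<? n
... | yes j<n = cong₂ ℤ._+_ (heights-cong a b e j) (e (fromℕ< j<n))
... | no _ = heights-cong a b e j

-- Heights determine the number of pairs: each point contributes its step
-- plus twice its "closing" indicator, and this sum is always 1, so
-- h_m(a) + 2·#(closers among the first m points) = m.
closingOf : ∀ {n} → ℕ → Maybe (Fin n) → ℕ
closingOf m nothing = 0
closingOf m (just k) with toℕ k ℕ.<? m
... | yes _ = 1
... | no _ = 0

closers-suc : ∀ {n} (a : Raw n) m (m<n : m < n) →
              closers a (suc m) m<n ≡ closingOf m (a (fromℕ< m<n)) + closers a m (ℕP.<⇒≤ m<n)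
closers-suc a m m<n with a (fromℕ< m<n)
... | nothing = refl
... | just k with toℕ k ℕ.<? m
...   | yes _ = refl
...   | no _ = refl

step+closing≡1 : ∀ {n} (a : Raw n) (u : Fin n) → a u ≢ just u →
                 step a u ℤ.+ (+ 2 ℤ.* + closingOf (toℕ u) (a u)) ≡ + 1
step+closing≡1 a u u≁u =
  trans (cong (ℤ._+ (+ 2 ℤ.* + closingOf (toℕ u) (a u))) (step≡stepOf a u)) (byPartner (a u) u≁u)
  where
  byPartner : ∀ m → m ≢ just u → stepOf u m ℤ.+ (+ 2 ℤ.* + closingOf (toℕ u) m) ≡ + 1
  byPartner nothing _ = refl
  byPartner (just k) k≢u with toℕ u ℕ.<? toℕ k | toℕ k ℕ.<? toℕ u
  ... | yes _ | no _ = refl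
  ... | no _ | yes _ = refl
  ... | yes u<k | yes k<u = ⊥-elim (ℕP.<-asym u<k k<u)
  ... | no u≮k | no k≮u =
    ⊥-elim (k≢u (cong just (FinP.toℕ-injective (ℕP.≤-antisym (ℕP.≮⇒≥ u≮k) (ℕP.≮⇒≥ k≮u)))))

height+2closers≡length : ∀ {n} (a : Raw n) → (∀ i → a i ≢ just i) → ∀ m (m≤n : m ≤ n) →
                         h a m ℤ.+ + (2 * closers a m m≤n) ≡ + m
height+2closers≡length a irr zero m≤n = refl
height+2closers≡length a irr (suc m) m<n =
  begin
    h a (suc m) ℤ.+ + (2 * closers a (suc m) m<n)
  ≡⟨ cong₂ ℤ._+_ (height-suc a m m<n) (cong (λ w → + (2 * w)) (closers-suc a m m<n)) ⟩
    (H ℤ.+ S) ℤ.+ + (2 * (C + K))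
  ≡⟨ cong (λ w → (H ℤ.+ S) ℤ.+ w) (trans (ℤP.pos-* 2 (C + K)) (cong (+ 2 ℤ.*_) (ℤP.pos-+ C K))) ⟩
    (H ℤ.+ S) ℤ.+ (+ 2 ℤ.* (+ C ℤ.+ + K))
  ≡⟨ regroup H S (+ C) (+ K) ⟩
    (H ℤ.+ + 2 ℤ.* + K) ℤ.+ (S ℤ.+ + 2 ℤ.* + C)
  ≡⟨ cong₂ ℤ._+_ (trans (cong (λ w → H ℤ.+ w) (sym (ℤP.pos-* 2 K))) (height+2closers≡length a irr m (ℕP.<⇒≤ m<n)))
                 (trans (cong (λ w → S ℤ.+ + 2 ℤ.* + closingOf w (a u)) (sym (FinP.toℕ-fromℕ< m<n)))
                        (step+closing≡1 a u (irr u))) ⟩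
    + m ℤ.+ + 1
  ≡⟨ trans (sym (ℤP.pos-+ m 1)) (cong +_ (ℕP.+-comm m 1)) ⟩
    + suc m
  ∎
  where
  open ≡-Reasoning
  u : Fin _
  u = fromℕ< m<n
  H S : ℤ
  H = h a m
  S = step a u
  C K : ℕ
  C = closingOf m (a u)
  K = closers a m (ℕP.<⇒≤ m<n)
  regroup : ∀ H S C K → (H ℤ.+ S) ℤ.+ (+ 2 ℤ.* (C ℤ.+ K)) ≡ (H ℤ.+ + 2 ℤ.* K) ℤ.+ (S ℤ.+ + 2 ℤ.* C)
  regroup = solve-∀

pairs-from-final-height : ∀ {n} (a b : Raw n) → (∀ i → a i ≢ just i) → (∀ i → b i ≢ just i) →
                          h a n ≡ h b n → pairs a ≡ pairs b
pairs-from-final-height {n} a b irrA irrB hn≡ =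
  ℕP.*-cancelˡ-≡ (pairs a) (pairs b) 2 (ℤP.+-injective (∙-cancelʳ (h a n) _ _ (
    begin
      + (2 * pairs a) ℤ.+ h a n  ≡⟨ ℤP.+-comm _ (h a n) ⟩
      h a n ℤ.+ + (2 * pairs a)  ≡⟨ height+2closers≡length a irrA n ℕP.≤-refl ⟩
      + n                        ≡⟨ sym (height+2closers≡length b irrB n ℕP.≤-refl) ⟩
      h b n ℤ.+ + (2 * pairs b)  ≡⟨ cong (ℤ._+ + (2 * pairs b)) (sym hn≡) ⟩
      h a n ℤ.+ + (2 * pairs b)  ≡⟨ ℤP.+-comm (h a n) _ ⟩
      + (2 * pairs b) ℤ.+ h a n  ∎)))
  where open ≡-Reasoning

-- Comparing heights of two diagrams whose step sequences differ by a swap.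
-- passedBy s j is 2 once the point s lies among the first j points, and
-- bump s j is 2 exactly at the position j of s; so passedBy s is the running
-- sum of bump s.
passedBy : ∀ {n} → Fin n → ℕ → ℤ
passedBy s j with toℕ s ℕ.<? j
... | yes _ = + 2
... | no _ = + 0

bump : ∀ {n} → Fin n → ℕ → ℤ
bump s j with toℕ s ℕ.≟ j
... | yes _ = + 2
... | no _ = + 0

passedBy-after : ∀ {n} (s : Fin n) j → toℕ s < j → passedBy s j ≡ + 2
passedBy-after s j s<j with toℕ s ℕ.<? j
... | yes _ = refl
... | no s≮j = ⊥-elim (s≮j s<j)

passedBy-before : ∀ {n} (s : Fin n) j → ¬ (toℕ s < j) → passedBy s j ≡ + 0
passedBy-before s j s≮j with toℕ s ℕ.<? j
... | yes s<j = ⊥-elim (s≮j s<j)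
... | no _ = refl

passedBy-suc : ∀ {n} (s : Fin n) j → passedBy s (suc j) ≡ passedBy s j ℤ.+ bump s j
passedBy-suc s j with toℕ s ℕ.<? j | toℕ s ℕ.≟ j | toℕ s ℕ.<? suc j
... | yes _    | no _     | yes _ = refl
... | no _     | yes _    | yes _ = refl
... | no _     | no _     | no _  = refl
... | yes s<j  | yes refl | _ = ⊥-elim (ℕP.<-irrefl refl s<j)
... | yes s<j  | no _     | no s≮j+1 = ⊥-elim (s≮j+1 (ℕP.m<n⇒m<1+n s<j))
... | no _     | yes refl | no s≮j+1 = ⊥-elim (s≮j+1 (ℕP.n<1+n _))
... | no s≮j   | no s≢j   | yes s<j+1 = ⊥-elim (s≮j (ℕP.≤∧≢⇒< (ℕP.≤-pred s<j+1) s≢j))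

bump-here : ∀ {n} (s : Fin n) → bump s (toℕ s) ≡ + 2
bump-here s with toℕ s ℕ.≟ toℕ s
... | yes _ = refl
... | no s≢s = ⊥-elim (s≢s refl)

bump-elsewhere : ∀ {n} (s u : Fin n) → u ≢ s → bump s (toℕ u) ≡ + 0
bump-elsewhere s u u≢s with toℕ s ℕ.≟ toℕ u
... | yes e = ⊥-elim (u≢s (FinP.toℕ-injective (sym e)))
... | no _ = refl

-- a is obtained from b by moving a down-step from position t to position s:
-- the steps agree except that a steps down at s and up at t where b steps
-- up at s and down at t.
SwapSteps : ∀ {n} → Raw n → Raw n → Fin n → Fin n → Set
SwapSteps a b s t = ∀ u → step a u ℤ.+ bump s (toℕ u) ≡ step b u ℤ.+ bump t (toℕ u)

swapSteps : ∀ {n} (a b : Raw n) (s t : Fin n) → s ≢ t →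
            (∀ u → u ≢ s → u ≢ t → step a u ≡ step b u) →
            step a s ≡ -1ℤ → step b s ≡ + 1 → step a t ≡ + 1 → step b t ≡ -1ℤ →
            SwapSteps a b s t
swapSteps a b s t s≢t others as bs at bt u with u ≟ s | u ≟ t
... | yes refl | yes u≡t = ⊥-elim (s≢t u≡t)
... | yes refl | no u≢t
  rewrite as | bs | bump-here s | bump-elsewhere t s u≢t = refl
... | no u≢s | yes refl
  rewrite at | bt | bump-here t | bump-elsewhere s t u≢s = refl
... | no u≢s | no u≢t
  rewrite bump-elsewhere s u u≢s | bump-elsewhere t u u≢t = cong (ℤ._+ + 0) (others u u≢s u≢t)

passedBy-stable : ∀ {n} (v : Fin n) {j} → ¬ (j < n) → passedBy v j ≡ passedBy v (suc j)
passedBy-stable v {j} j≮n =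
  trans (passedBy-after v j v<j) (sym (passedBy-after v (suc j) (ℕP.m<n⇒m<1+n v<j)))
  where
  v<j : toℕ v < j
  v<j = ℕP.<-≤-trans (FinP.toℕ<n v) (ℕP.≮⇒≥ j≮n)

swap-heights : ∀ {n} (a b : Raw n) (s t : Fin n) → SwapSteps a b s t →
               ∀ j → h a j ℤ.+ passedBy s j ≡ h b j ℤ.+ passedBy t j
swap-heights a b s t swap zero
  rewrite passedBy-before s 0 (λ ()) | passedBy-before t 0 (λ ()) = refl
swap-heights {n} a b s t swap (suc j) with j ℕ.<? n
... | no j≮n = subst₂ (λ x y → h a j ℤ.+ x ≡ h b j ℤ.+ y)
                      (passedBy-stable s j≮n) (passedBy-stable t j≮n) (swap-heights a b s t swap j)
... | yes j<n =
  begin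
    (h a j ℤ.+ step a u) ℤ.+ passedBy s (suc j)
  ≡⟨ cong (λ w → (h a j ℤ.+ step a u) ℤ.+ w) (passedBy-suc s j) ⟩
    (h a j ℤ.+ step a u) ℤ.+ (passedBy s j ℤ.+ bump s j)
  ≡⟨ interchange (h a j) (step a u) (passedBy s j) (bump s j) ⟩
    (h a j ℤ.+ passedBy s j) ℤ.+ (step a u ℤ.+ bump s j)
  ≡⟨ cong₂ ℤ._+_ (swap-heights a b s t swap j) swapAt-j ⟩
    (h b j ℤ.+ passedBy t j) ℤ.+ (step b u ℤ.+ bump t j)
  ≡⟨ sym (interchange (h b j) (step b u) (passedBy t j) (bump t j)) ⟩
    (h b j ℤ.+ step b u) ℤ.+ (passedBy t j ℤ.+ bump t j)
  ≡⟨ cong (λ w → (h b j ℤ.+ step b u) ℤ.+ w) (sym (passedBy-suc t j)) ⟩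
    (h b j ℤ.+ step b u) ℤ.+ passedBy t (suc j)
  ∎
  where
  open ≡-Reasoning
  u : Fin n
  u = fromℕ< j<n
  swapAt-j : step a u ℤ.+ bump s j ≡ step b u ℤ.+ bump t j
  swapAt-j = subst (λ k → step a u ℤ.+ bump s k ≡ step b u ℤ.+ bump t k) (FinP.toℕ-fromℕ< j<n) (swap u)
  interchange : ∀ A B C D → (A ℤ.+ B) ℤ.+ (C ℤ.+ D) ≡ (A ℤ.+ C) ℤ.+ (B ℤ.+ D)
  interchange = solve-∀

record BelowExcept {n : ℕ} (a b : Raw n) (m : ℕ) : Set where
  field
    below : ∀ j → j ≢ m → h a j ℤ.≤ h b j
    final : h a n ≡ h b n

cancel-≤ : ∀ A B I T → A ℤ.+ I ≡ B ℤ.+ T → T ℤ.≤ I → A ℤ.≤ B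
cancel-≤ A B I T e T≤I = subst₂ ℤ._≤_ (plus-minus A I) (plus-minus B I)
    (subst (λ w → w ℤ.+ ℤ.- I ℤ.≤ (B ℤ.+ I) ℤ.+ ℤ.- I) (sym e)
       (ℤP.+-monoˡ-≤ (ℤ.- I) (ℤP.+-monoʳ-≤ B T≤I)))
  where
  plus-minus : ∀ A I → (A ℤ.+ I) ℤ.+ ℤ.- I ≡ A
  plus-minus = solve-∀

swap-final : ∀ {n} (a b : Raw n) (s t : Fin n) → SwapSteps a b s t → h a n ≡ h b n
swap-final {n} a b s t swap = ∙-cancelʳ (+ 2) (h a n) (h b n)
  (subst₂ (λ x y → h a n ℤ.+ x ≡ h b n ℤ.+ y)
     (passedBy-after s n (FinP.toℕ<n s)) (passedBy-after t n (FinP.toℕ<n t)) (swap-heights a b s t swap n))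

swap-earlier : ∀ {n} (a b : Raw n) (s t : Fin n) → SwapSteps a b s t → toℕ s < toℕ t →
               ∀ m → BelowExcept a b m
swap-earlier a b s t swap s<t m = record
  { below = λ j _ → cancel-≤ (h a j) (h b j) (passedBy s j) (passedBy t j) (swap-heights a b s t swap j) (passed-≤ j)
  ; final = swap-final a b s t swap }
  where
  passed-≤ : ∀ j → passedBy t j ℤ.≤ passedBy s j
  passed-≤ j with toℕ t ℕ.<? j | toℕ s ℕ.<? j
  ... | yes _ | yes _ = ℤP.≤-refl
  ... | yes t<j | no s≮j = ⊥-elim (s≮j (ℕP.<-trans s<t t<j))
  ... | no _ | yes _ = ℤ.+≤+ ℕ.z≤n
  ... | no _ | no _ = ℤP.≤-refl

swap-adjacent : ∀ {n} (a b : Raw n) (s t : Fin n) → SwapSteps a b s t → toℕ s ≡ suc (toℕ t) →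
                BelowExcept a b (toℕ s)
swap-adjacent a b s t swap s≡t+1 = record
  { below = λ j j≢s → ℤP.≤-reflexive (∙-cancelʳ (passedBy s j) (h a j) (h b j)
              (trans (swap-heights a b s t swap j) (cong (λ w → h b j ℤ.+ w) (sym (passed-≡ j j≢s)))))
  ; final = swap-final a b s t swap }
  where
  passed-≡ : ∀ j → j ≢ toℕ s → passedBy s j ≡ passedBy t j
  passed-≡ j j≢s with toℕ s ℕ.<? j | toℕ t ℕ.<? j
  ... | yes _ | yes _ = refl
  ... | no _ | no _ = refl
  ... | yes s<j | no t≮j = ⊥-elim (t≮j (ℕP.<-trans (ℕP.n<1+n _) (subst (_< j) s≡t+1 s<j)))
  ... | no s≮j | yes t<j = ⊥-elim (s≮j (subst (_< j) (sym s≡t+1) (ℕP.≤∧≢⇒< t<j (λ e → j≢s (trans (sym e) (sym s≡t+1))))))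

same-steps : ∀ {n} (a b : Raw n) → (∀ u → step a u ≡ step b u) → ∀ m → BelowExcept a b m
same-steps {n} a b e m = record
  { below = λ j _ → ℤP.≤-reflexive (heights-cong a b e j) ; final = heights-cong a b e n }

data Parity (m : ℕ) : Set where
  even : ∀ k → m ≡ 2 * k → Parity m
  odd  : ∀ k → m ≡ suc (2 * k) → Parity m

parity : ∀ m → Parity m
parity zero = even 0 refl
parity (suc m) with parity m
... | even k m≡2k = odd k (cong suc m≡2k)
... | odd k m≡2k+1 = even (suc k) (trans (cong suc m≡2k+1) (cong suc (sym (ℕP.+-suc k (k + 0)))))

even%2 : ∀ k → (2 * k) % 2 ≡ 0
even%2 k = trans (cong (_% 2) (ℕP.*-comm 2 k)) (m*n%n≡0 k 2)

odd%2 : ∀ k → (suc (2 * k)) % 2 ≡ 1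
odd%2 k = trans (cong (λ w → suc w % 2) (ℕP.*-comm 2 k)) ([m+kn]%n≡m%n 1 k 2)

data Partners (m m' : ℕ) : Set where
  opens  : ∀ k → m ≡ 2 * k → m' ≡ suc (2 * k) → Partners m m'
  closes : ∀ k → m ≡ suc (2 * k) → m' ≡ 2 * k → Partners m m'

partners-sym : ∀ {m m'} → Partners m m' → Partners m' m
partners-sym (opens k e e') = closes k e' e
partners-sym (closes k e e') = opens k e' e

partners-nothing-between : ∀ {m m' l} → Partners m m' → m < l → l < m' → ⊥
partners-nothing-between (opens k refl refl) m<l l<m' = ℕP.<-irrefl refl (ℕP.<-≤-trans m<l (ℕP.≤-pred l<m'))
partners-nothing-between (closes k refl refl) m<l l<m' = ℕP.<-asym (ℕP.<-trans m<l l<m') (ℕP.n<1+n _)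

partners-irrefl : ∀ {m} → Partners m m → ⊥
partners-irrefl (opens k e e') = ℕP.1+n≢n (trans (sym e') e)
partners-irrefl (closes k e e') = ℕP.1+n≢n (trans (sym e) e')

partners-bound : ∀ {m m'} p → m < 2 * p → Partners m m' → m' < 2 * p
partners-bound p m<2p (closes k refl refl) = ℕP.<-trans (ℕP.n<1+n _) m<2p
partners-bound p m<2p (opens k refl refl) =
  subst (_≤ 2 * p) (cong suc (ℕP.+-suc k (k + 0))) (ℕP.*-monoʳ-≤ 2 (ℕP.*-cancelˡ-< 2 k p m<2p))

minDiag-outside : ∀ {n} p (j : Fin n) → ¬ (toℕ j < 2 * p) → minDiag p j ≡ nothing
minDiag-outside p j j≮2p with toℕ j ℕ.<? 2 * p
... | yes j<2p = ⊥-elim (j≮2p j<2p)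
... | no _ = refl

minDiag-sound : ∀ {n} p (j k : Fin n) → minDiag p j ≡ just k → toℕ j < 2 * p × Partners (toℕ j) (toℕ k)
minDiag-sound {n} p j k eq with toℕ j ℕ.<? 2 * p
minDiag-sound {n} p j k () | no _
... | yes j<2p with toℕ j % 2 ℕ.≟ 0
...   | yes j%2≡0 with suc (toℕ j) ℕ.<? n
...     | no _ = ⊥-elim (nothing≢just eq)
...     | yes j+1<n with parity (toℕ j) | just-injective eq
...       | even h j≡2h | refl = j<2p , opens h j≡2h (trans (FinP.toℕ-fromℕ< j+1<n) (cong suc j≡2h))
...       | odd h j≡2h+1 | _ = ⊥-elim (ℕP.1+n≢0 (trans (sym (odd%2 h)) (trans (cong (_% 2) (sym j≡2h+1)) j%2≡0)))
minDiag-sound {n} p j k eq | yes j<2p | no j%2≢0 with toℕ j ∸ 1 ℕ.<? n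
...     | no _ = ⊥-elim (nothing≢just eq)
...     | yes j-1<n with parity (toℕ j) | just-injective eq
...       | odd h j≡2h+1 | refl = j<2p , closes h j≡2h+1 (trans (FinP.toℕ-fromℕ< j-1<n) (cong (_∸ 1) j≡2h+1))
...       | even h j≡2h | _ = ⊥-elim (j%2≢0 (trans (cong (_% 2) j≡2h) (even%2 h)))

partner-of-even : ∀ {m m'} → Partners m m' → m % 2 ≡ 0 → suc m ≡ m'
partner-of-even (opens k refl refl) _ = refl
partner-of-even (closes k refl refl) odd≡0 = ⊥-elim (ℕP.1+n≢0 (trans (sym (odd%2 k)) odd≡0))

partner-of-odd : ∀ {m m'} → Partners m m' → m % 2 ≢ 0 → m ∸ 1 ≡ m'
partner-of-odd (closes k refl refl) _ = refl
partner-of-odd (opens k refl refl) even≢0 = ⊥-elim (even≢0 (even%2 k))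

minDiag-complete : ∀ {n} p (j k : Fin n) → toℕ j < 2 * p → Partners (toℕ j) (toℕ k) → minDiag p j ≡ just k
minDiag-complete {n} p j k j<2p jk with toℕ j ℕ.<? 2 * p
... | no j≮2p = ⊥-elim (j≮2p j<2p)
... | yes _ with toℕ j % 2 ℕ.≟ 0
...   | yes j%2≡0 with suc (toℕ j) ℕ.<? n
...     | yes j+1<n = cong just (FinP.toℕ-injective (trans (FinP.toℕ-fromℕ< j+1<n) (partner-of-even jk j%2≡0)))
...     | no j+1≮n = ⊥-elim (j+1≮n (subst (_< n) (sym (partner-of-even jk j%2≡0)) (FinP.toℕ<n k)))
minDiag-complete {n} p j k j<2p jk | yes _ | no j%2≢0 with toℕ j ∸ 1 ℕ.<? n
...     | yes j-1<n = cong just (FinP.toℕ-injective (trans (FinP.toℕ-fromℕ< j-1<n) (partner-of-odd jk j%2≢0)))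
...     | no j-1≮n = ⊥-elim (j-1≮n (ℕP.≤-<-trans (ℕP.m∸n≤m (toℕ j) 1) (FinP.toℕ<n j)))

minDiag-isHalfDiagram : ∀ {n} p → IsHalfDiagram (minDiag {n} p)
minDiag-isHalfDiagram {n} p = record
  { symmetric = symmetric
  ; irreflexive = λ i eq → partners-irrefl (proj₂ (minDiag-sound p i i eq))
  ; noncrossing = λ i j k l eq _ i<k k<j _ → nothing-between i j k eq i<k k<j
  ; noEnclosedThrough = λ i j k eq _ i<k k<j → nothing-between i j k eq i<k k<j }
  where
  symmetric : ∀ i j → minDiag p i ≡ just j → minDiag p j ≡ just i
  symmetric i j eq with minDiag-sound p i j eq
  ... | i<2p , ij = minDiag-complete p j i (partners-bound p i<2p ij) (partners-sym ij)
  nothing-between : ∀ i j k → minDiag p i ≡ just j → i Fin.< k → k Fin.< j → ⊥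
  nothing-between i j k eq = partners-nothing-between (proj₂ (minDiag-sound p i j eq))

closingOf-earlier : ∀ {n} m (k : Fin n) → toℕ k < m → closingOf m (just k) ≡ 1
closingOf-earlier m k k<m with toℕ k ℕ.<? m
... | yes _ = refl
... | no k≮m = ⊥-elim (k≮m k<m)

closingOf-later : ∀ {n} m (k : Fin n) → ¬ (toℕ k < m) → closingOf m (just k) ≡ 0
closingOf-later m k k≮m with toℕ k ℕ.<? m
... | yes k<m = ⊥-elim (k≮m k<m)
... | no _ = refl

closers-cong : ∀ {n} (a : Raw n) {m m'} → m ≡ m' → (m≤n : m ≤ n) (m'≤n : m' ≤ n) →
               closers a m m≤n ≡ closers a m' m'≤n
closers-cong a refl m≤n m'≤n = cong (closers a _) (ℕP.≤-irrelevant m≤n m'≤n)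

module _ {n : ℕ} (p : ℕ) where

  closing-minDiag-even : ∀ k (u : Fin n) → toℕ u ≡ 2 * k → closingOf (2 * k) (minDiag p u) ≡ 0
  closing-minDiag-even k u u≡2k with minDiag p u in eq
  ... | nothing = refl
  ... | just v = closingOf-later (2 * k) v (λ v<2k → ℕP.<-asym v<2k (subst (_< toℕ v) u≡2k u<v))
    where
    u<v : toℕ u < toℕ v
    u<v = ℕP.≤-reflexive (partner-of-even (proj₂ (minDiag-sound p u v eq)) (trans (cong (_% 2) u≡2k) (even%2 k)))

  closing-minDiag-odd : ∀ k (u : Fin n) → toℕ u ≡ suc (2 * k) → suc (2 * k) < 2 * p →
                        closingOf (suc (2 * k)) (minDiag p u) ≡ 1
  closing-minDiag-odd k u u≡2k+1 2k+1<2p =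
    trans (cong (closingOf (suc (2 * k))) (minDiag-complete p u v (subst (_< 2 * p) (sym u≡2k+1) 2k+1<2p) partners))
          (closingOf-earlier (suc (2 * k)) v (subst (_< suc (2 * k)) (sym v≡2k) ℕP.≤-refl))
    where
    2k<n : 2 * k < n
    2k<n = ℕP.<-trans (ℕP.n<1+n _) (subst (_< n) u≡2k+1 (FinP.toℕ<n u))
    v : Fin n
    v = fromℕ< 2k<n
    v≡2k : toℕ v ≡ 2 * k
    v≡2k = FinP.toℕ-fromℕ< 2k<n
    partners : Partners (toℕ u) (toℕ v)
    partners = closes k u≡2k+1 v≡2k

  closers-minDiag-even : ∀ k (2k≤n : 2 * k ≤ n) → k ≤ p → closers (minDiag p) (2 * k) 2k≤n ≡ k
  closers-minDiag-even zero _ _ = refl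
  closers-minDiag-even (suc k) 2k+2≤n k<p =
    begin
      closers a (2 * suc k) 2k+2≤n
    ≡⟨ closers-cong a 2[k+1]≡ 2k+2≤n 2k+2≤n′ ⟩
      closers a (suc (suc (2 * k))) 2k+2≤n′
    ≡⟨ closers-suc a (suc (2 * k)) 2k+2≤n′ ⟩
      closingOf (suc (2 * k)) (a (fromℕ< 2k+2≤n′)) + closers a (suc (2 * k)) 2k+1≤n
    ≡⟨ cong₂ _+_ (closing-minDiag-odd k (fromℕ< 2k+2≤n′) (FinP.toℕ-fromℕ< 2k+2≤n′) 2k+1<2p)
                 (closers-suc a (2 * k) 2k+1≤n) ⟩
      1 + (closingOf (2 * k) (a (fromℕ< 2k+1≤n)) + closers a (2 * k) (ℕP.<⇒≤ 2k+1≤n))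
    ≡⟨ cong (λ w → 1 + (w + closers a (2 * k) (ℕP.<⇒≤ 2k+1≤n))) (closing-minDiag-even k (fromℕ< 2k+1≤n) (FinP.toℕ-fromℕ< 2k+1≤n)) ⟩
      1 + closers a (2 * k) (ℕP.<⇒≤ 2k+1≤n)
    ≡⟨ cong suc (closers-minDiag-even k _ (ℕP.<⇒≤ k<p)) ⟩
      suc k
    ∎
    where
    open ≡-Reasoning
    a : Raw n
    a = minDiag p
    2[k+1]≡ : 2 * suc k ≡ suc (suc (2 * k))
    2[k+1]≡ = cong suc (ℕP.+-suc k (k + 0))
    2k+2≤n′ : suc (suc (2 * k)) ≤ n
    2k+2≤n′ = subst (_≤ n) 2[k+1]≡ 2k+2≤n
    2k+1≤n : suc (2 * k) ≤ n
    2k+1≤n = ℕP.<⇒≤ 2k+2≤n′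
    2k+1<2p : suc (2 * k) < 2 * p
    2k+1<2p = subst (_≤ 2 * p) 2[k+1]≡ (ℕP.*-monoʳ-≤ 2 k<p)

  closers-minDiag : ∀ m (m≤n : m ≤ n) → 2 * p ≤ m → closers (minDiag p) m m≤n ≡ p
  closers-minDiag m m≤n 2p≤m with ℕP.<-cmp (2 * p) m
  ... | tri≈ _ 2p≡m _ = trans (closers-cong (minDiag p) (sym 2p≡m) m≤n (subst (_≤ n) (sym 2p≡m) m≤n))
                              (closers-minDiag-even p _ ℕP.≤-refl)
  ... | tri> _ _ 2p>m = ⊥-elim (ℕP.<-irrefl refl (ℕP.<-≤-trans 2p>m 2p≤m))
  closers-minDiag (suc m) m<n _ | tri< 2p<m+1 _ _ =
    trans (closers-suc (minDiag p) m m<n)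
          (cong₂ _+_ (cong (closingOf m) (minDiag-outside p (fromℕ< m<n) m≮2p))
                     (closers-minDiag m _ (ℕP.≤-pred 2p<m+1)))
    where
    m≮2p : ¬ (toℕ (fromℕ< m<n) < 2 * p)
    m≮2p lt = ℕP.<-irrefl refl (ℕP.<-≤-trans (subst (_< 2 * p) (FinP.toℕ-fromℕ< m<n) lt) (ℕP.≤-pred 2p<m+1))

  minDiag-pairs : 2 * p ≤ n → pairs (minDiag {n} p) ≡ p
  minDiag-pairs 2p≤n = closers-minDiag n ℕP.≤-refl 2p≤n

-- The cap joins x with y, and the cup reconnects the
-- former partners of x and y (a partner left without a mate becomes a
-- through-string).
module Gluing {n : ℕ} (x y : Fin n) (y≡x+1 : toℕ y ≡ suc (toℕ x)) (c : Raw n)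
              (hc : IsHalfDiagram c) (x≁y : c x ≢ just y) where
  open IsHalfDiagram hc renaming (noncrossing to crossing; noEnclosedThrough to enclosing)

  g : Raw n
  g = glue x y c

  x<y : toℕ x < toℕ y
  x<y = subst (toℕ x <_) (sym y≡x+1) (ℕP.n<1+n _)

  x≢y : x ≢ y
  x≢y e = ℕP.<-irrefl (cong toℕ e) x<y

  above-x : ∀ {m} → toℕ x < m → m ≢ toℕ y → toℕ y < m
  above-x x<m m≢y = ℕP.≤∧≢⇒< (subst (_≤ _) (sym y≡x+1) x<m) (λ e → m≢y (sym e))

  below-y : ∀ {m} → m < toℕ y → m ≢ toℕ x → m < toℕ x
  below-y m<y m≢x = ℕP.≤∧≢⇒< (ℕP.≤-pred (subst (suc _ ≤_) y≡x+1 m<y)) m≢x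

  nothing-between : ∀ {m} → toℕ x < m → m < toℕ y → ⊥
  nothing-between x<m m<y = ℕP.<-asym x<m (below-y m<y (λ e → ℕP.<-irrefl (sym e) x<m))

  toℕ-≢ : ∀ {i j : Fin n} → i ≢ j → toℕ i ≢ toℕ j
  toℕ-≢ i≢j e = i≢j (FinP.toℕ-injective e)

  partner-injective : ∀ {i k z} → c i ≡ just z → c k ≡ just z → i ≡ k
  partner-injective {i} {k} {z} ci ck = just-injective (trans (sym (symmetric i z ci)) (symmetric k z ck))

  y≁x : c y ≢ just x
  y≁x e = x≁y (symmetric y x e)

  data GlueArc (j k : Fin n) : Set where
    cap-xy : j ≡ x → k ≡ y → GlueArc j k
    cap-yx : j ≡ y → k ≡ x → GlueArc j k
    kept   : j ≢ x → j ≢ y → k ≢ x → k ≢ y → c j ≡ just k → GlueArc j k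
    via-x  : c j ≡ just x → c y ≡ just k → GlueArc j k
    via-y  : c j ≡ just y → c x ≡ just k → GlueArc j k

  data GlueThrough (k : Fin n) : Set where
    kept   : k ≢ x → k ≢ y → c k ≡ nothing → GlueThrough k
    via-x  : c k ≡ just x → c y ≡ nothing → GlueThrough k
    via-y  : c k ≡ just y → c x ≡ nothing → GlueThrough k

  glueArc : ∀ j k → g j ≡ just k → GlueArc j k
  glueArc j k eq with j ≟ x | j ≟ y
  ... | yes refl | _ = cap-xy refl (sym (just-injective eq))
  ... | no _ | yes refl = cap-yx refl (sym (just-injective eq))
  ... | no j≢x | no j≢y with c j in cj
  ...   | nothing = ⊥-elim (nothing≢just eq)
  ...   | just z with z ≟ x | z ≟ y
  ...     | yes refl | _ = via-x cj eq
  ...     | no _ | yes refl = via-y cj eq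
  ...     | no z≢x | no z≢y with just-injective eq
  ...       | refl = kept j≢x j≢y z≢x z≢y cj

  glueThrough : ∀ k → g k ≡ nothing → GlueThrough k
  glueThrough k eq with k ≟ x | k ≟ y
  ... | yes refl | _ = ⊥-elim (nothing≢just (sym eq))
  ... | no _ | yes refl = ⊥-elim (nothing≢just (sym eq))
  ... | no k≢x | no k≢y with c k in ck
  ...   | nothing = kept k≢x k≢y ck
  ...   | just z with z ≟ x | z ≟ y
  ...     | yes refl | _ = via-x ck eq
  ...     | no _ | yes refl = via-y ck eq
  ...     | no _ | no _ = ⊥-elim (nothing≢just (sym eq))

  g-x : g x ≡ just y
  g-x with x ≟ x
  ... | yes _ = refl
  ... | no x≢x = ⊥-elim (x≢x refl)

  g-y : g y ≡ just x
  g-y with y ≟ x | y ≟ y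
  ... | yes y≡x | _ = ⊥-elim (x≢y (sym y≡x))
  ... | no _ | yes _ = refl
  ... | no _ | no y≢y = ⊥-elim (y≢y refl)

  g-kept : ∀ {j z} → j ≢ x → j ≢ y → c j ≡ just z → z ≢ x → z ≢ y → g j ≡ just z
  g-kept {j} {z} j≢x j≢y cj z≢x z≢y with j ≟ x | j ≟ y
  ... | yes e | _ = ⊥-elim (j≢x e)
  ... | no _ | yes e = ⊥-elim (j≢y e)
  ... | no _ | no _ rewrite cj with z ≟ x | z ≟ y
  ...   | yes e | _ = ⊥-elim (z≢x e)
  ...   | no _ | yes e = ⊥-elim (z≢y e)
  ...   | no _ | no _ = refl

  g-via-x : ∀ {j} → j ≢ x → j ≢ y → c j ≡ just x → g j ≡ c y
  g-via-x {j} j≢x j≢y cj with j ≟ x | j ≟ y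
  ... | yes e | _ = ⊥-elim (j≢x e)
  ... | no _ | yes e = ⊥-elim (j≢y e)
  ... | no _ | no _ rewrite cj with x ≟ x
  ...   | yes _ = refl
  ...   | no x≢x = ⊥-elim (x≢x refl)

  g-via-y : ∀ {j} → j ≢ x → j ≢ y → c j ≡ just y → g j ≡ c x
  g-via-y {j} j≢x j≢y cj with j ≟ x | j ≟ y
  ... | yes e | _ = ⊥-elim (j≢x e)
  ... | no _ | yes e = ⊥-elim (j≢y e)
  ... | no _ | no _ rewrite cj with y ≟ x | y ≟ y
  ...   | yes y≡x | _ = ⊥-elim (x≢y (sym y≡x))
  ...   | no _ | yes _ = refl
  ...   | no _ | no y≢y = ⊥-elim (y≢y refl)

  g-through : ∀ {j} → j ≢ x → j ≢ y → c j ≡ nothing → g j ≡ nothing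
  g-through {j} j≢x j≢y cj with j ≟ x | j ≟ y
  ... | yes e | _ = ⊥-elim (j≢x e)
  ... | no _ | yes e = ⊥-elim (j≢y e)
  ... | no _ | no _ rewrite cj = refl

  partner-of-x-≢x : ∀ {j} → c j ≡ just x → j ≢ x
  partner-of-x-≢x cj refl = irreflexive _ cj
  partner-of-x-≢y : ∀ {j} → c j ≡ just x → j ≢ y
  partner-of-x-≢y cj refl = y≁x cj
  partner-of-y-≢x : ∀ {j} → c j ≡ just y → j ≢ x
  partner-of-y-≢x cj refl = x≁y cj
  partner-of-y-≢y : ∀ {j} → c j ≡ just y → j ≢ y
  partner-of-y-≢y cj refl = irreflexive _ cj

  g-symmetric : ∀ i j → g i ≡ just j → g j ≡ just i
  g-symmetric i j gij with glueArc i j gij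
  ... | cap-xy refl refl = g-y
  ... | cap-yx refl refl = g-x
  ... | kept i≢x i≢y j≢x j≢y cij = g-kept j≢x j≢y (symmetric i j cij) i≢x i≢y
  ... | via-x cix cyj = trans (g-via-y (partner-of-y-≢x cjy) (partner-of-y-≢y cjy) cjy) (symmetric i x cix)
    where cjy = symmetric y j cyj
  ... | via-y ciy cxj = trans (g-via-x (partner-of-x-≢x cjx) (partner-of-x-≢y cjx) cjx) (symmetric i y ciy)
    where cjx = symmetric x j cxj

  g-irreflexive : ∀ i → g i ≢ just i
  g-irreflexive i gii with glueArc i i gii
  ... | cap-xy refl x≡y = x≢y x≡y
  ... | cap-yx refl y≡x = x≢y (sym y≡x)
  ... | kept _ _ _ _ cii = irreflexive i cii
  ... | via-x cix cyi = x≢y (partner-injective (symmetric i x cix) cyi)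
  ... | via-y ciy cxi = x≢y (partner-injective cxi (symmetric i y ciy))

  <-≢ : ∀ {a b} → a < b → a ≢ b
  <-≢ a<b a≡b = ℕP.<-irrefl a≡b a<b

  kept-crosses-via-x : ∀ {i j k l} → i ≢ x → j ≢ x → j ≢ y → c i ≡ just j → c k ≡ just x → c y ≡ just l →
                       i Fin.< k → k Fin.< j → j Fin.< l → ⊥
  kept-crosses-via-x {i} {j} {k} {l} i≢x j≢x j≢y cij ckx cyl i<k k<j j<l with ℕP.<-cmp (toℕ x) (toℕ i)
  ... | tri< x<i _ _ = crossing x k i j (symmetric k x ckx) cij x<i i<k k<j
  ... | tri≈ _ x≡i _ = i≢x (FinP.toℕ-injective (sym x≡i))
  ... | tri> _ _ i<x with ℕP.<-cmp (toℕ x) (toℕ j)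
  ...   | tri< x<j _ _ = crossing i j y l cij cyl (ℕP.<-trans i<x x<y) (above-x x<j (toℕ-≢ j≢y)) j<l
  ...   | tri≈ _ x≡j _ = j≢x (FinP.toℕ-injective (sym x≡j))
  ...   | tri> _ _ j<x = crossing i j k x cij ckx i<k k<j j<x

  kept-crosses-via-y : ∀ {i j k l} → i ≢ x → i ≢ y → j ≢ x → c i ≡ just j → c k ≡ just y → c x ≡ just l →
                       i Fin.< k → k Fin.< j → j Fin.< l → ⊥
  kept-crosses-via-y {i} {j} {k} {l} i≢x i≢y j≢x cij cky cxl i<k k<j j<l with ℕP.<-cmp (toℕ y) (toℕ i)
  ... | tri< y<i _ _ = crossing y k i j (symmetric k y cky) cij y<i i<k k<j
  ... | tri≈ _ y≡i _ = i≢y (FinP.toℕ-injective (sym y≡i))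
  ... | tri> _ _ i<y with ℕP.<-cmp (toℕ x) (toℕ j)
  ...   | tri< x<j _ _ = crossing i j x l cij cxl (below-y i<y (toℕ-≢ i≢x)) x<j j<l
  ...   | tri≈ _ x≡j _ = j≢x (FinP.toℕ-injective (sym x≡j))
  ...   | tri> _ _ j<x = crossing i j k y cij cky i<k k<j (ℕP.<-trans j<x x<y)

  via-x-crosses-kept : ∀ {i j k l} → k ≢ x → k ≢ y → l ≢ x → c i ≡ just x → c y ≡ just j → c k ≡ just l →
                       i Fin.< k → k Fin.< j → j Fin.< l → ⊥
  via-x-crosses-kept {i} {j} {k} {l} k≢x k≢y l≢x cix cyj ckl i<k k<j j<l with ℕP.<-cmp (toℕ x) (toℕ k)
  ... | tri< x<k _ _ = crossing y j k l cyj ckl (above-x x<k (toℕ-≢ k≢y)) k<j j<l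
  ... | tri≈ _ x≡k _ = k≢x (FinP.toℕ-injective (sym x≡k))
  ... | tri> _ _ k<x with ℕP.<-cmp (toℕ x) (toℕ l)
  ...   | tri< x<l _ _ = crossing i x k l cix ckl i<k k<x x<l
  ...   | tri≈ _ x≡l _ = l≢x (FinP.toℕ-injective (sym x≡l))
  ...   | tri> _ _ l<x = crossing k l j y ckl (symmetric y j cyj) k<j j<l (ℕP.<-trans l<x x<y)

  via-y-crosses-kept : ∀ {i j k l} → k ≢ y → l ≢ x → l ≢ y → c i ≡ just y → c x ≡ just j → c k ≡ just l →
                       i Fin.< k → k Fin.< j → j Fin.< l → ⊥
  via-y-crosses-kept {i} {j} {k} {l} k≢y l≢x l≢y ciy cxj ckl i<k k<j j<l with ℕP.<-cmp (toℕ y) (toℕ k)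
  ... | tri< y<k _ _ = crossing x j k l cxj ckl (ℕP.<-trans x<y y<k) k<j j<l
  ... | tri≈ _ y≡k _ = k≢y (FinP.toℕ-injective (sym y≡k))
  ... | tri> _ _ k<y with ℕP.<-cmp (toℕ y) (toℕ l)
  ...   | tri< y<l _ _ = crossing i y k l ciy ckl i<k k<y y<l
  ...   | tri≈ _ y≡l _ = l≢y (FinP.toℕ-injective (sym y≡l))
  ...   | tri> _ _ l<y = crossing k l j x ckl (symmetric x j cxj) k<j j<l (below-y l<y (toℕ-≢ l≢x))

  g-noncrossing : ∀ i j k l → g i ≡ just j → g k ≡ just l → i Fin.< k → k Fin.< j → j Fin.< l → ⊥
  g-noncrossing i j k l gij gkl i<k k<j j<l with glueArc i j gij | glueArc k l gkl
  ... | cap-xy refl refl | _ = nothing-between i<k k<j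
  ... | cap-yx refl refl | _ = ℕP.<-asym x<y (ℕP.<-trans i<k k<j)
  ... | _ | cap-xy refl refl = nothing-between k<j j<l
  ... | _ | cap-yx refl refl = ℕP.<-asym x<y (ℕP.<-trans k<j j<l)
  ... | kept _ _ _ _ cij | kept _ _ _ _ ckl = crossing i j k l cij ckl i<k k<j j<l
  ... | kept i≢x _ j≢x j≢y cij | via-x ckx cyl = kept-crosses-via-x i≢x j≢x j≢y cij ckx cyl i<k k<j j<l
  ... | kept i≢x i≢y j≢x _ cij | via-y cky cxl = kept-crosses-via-y i≢x i≢y j≢x cij cky cxl i<k k<j j<l
  ... | via-x cix cyj | kept k≢x k≢y l≢x _ ckl = via-x-crosses-kept k≢x k≢y l≢x cix cyj ckl i<k k<j j<l
  ... | via-y ciy cxj | kept _ k≢y l≢x l≢y ckl = via-y-crosses-kept k≢y l≢x l≢y ciy cxj ckl i<k k<j j<l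
  ... | via-x cix _ | via-x ckx _ = <-≢ i<k (cong toℕ (partner-injective cix ckx))
  ... | via-y ciy _ | via-y cky _ = <-≢ i<k (cong toℕ (partner-injective ciy cky))
  ... | via-x _ cyj | via-y cky _ = <-≢ k<j (cong toℕ (just-injective (trans (sym (symmetric k y cky)) cyj)))
  ... | via-y _ cxj | via-x ckx _ = <-≢ k<j (cong toℕ (just-injective (trans (sym (symmetric k x ckx)) cxj)))

  kept-encloses-via-x : ∀ {i j k} → i ≢ y → j ≢ x → j ≢ y → c i ≡ just j → c k ≡ just x → c y ≡ nothing →
                        i Fin.< k → k Fin.< j → ⊥
  kept-encloses-via-x {i} {j} {k} i≢y j≢x j≢y cij ckx cy i<k k<j with ℕP.<-cmp (toℕ y) (toℕ i)
  ... | tri< y<i _ _ = crossing x k i j (symmetric k x ckx) cij (ℕP.<-trans x<y y<i) i<k k<j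
  ... | tri≈ _ y≡i _ = i≢y (FinP.toℕ-injective (sym y≡i))
  ... | tri> _ _ i<y with ℕP.<-cmp (toℕ y) (toℕ j)
  ...   | tri< y<j _ _ = enclosing i j y cij cy i<y y<j
  ...   | tri≈ _ y≡j _ = j≢y (FinP.toℕ-injective (sym y≡j))
  ...   | tri> _ _ j<y = crossing i j k x cij ckx i<k k<j (below-y j<y (toℕ-≢ j≢x))

  kept-encloses-via-y : ∀ {i j k} → i ≢ x → i ≢ y → j ≢ x → c i ≡ just j → c k ≡ just y → c x ≡ nothing →
                        i Fin.< k → k Fin.< j → ⊥
  kept-encloses-via-y {i} {j} {k} i≢x i≢y j≢x cij cky cx i<k k<j with ℕP.<-cmp (toℕ x) (toℕ i)
  ... | tri< x<i _ _ = crossing y k i j (symmetric k y cky) cij (above-x x<i (toℕ-≢ i≢y)) i<k k<j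
  ... | tri≈ _ x≡i _ = i≢x (FinP.toℕ-injective (sym x≡i))
  ... | tri> _ _ i<x with ℕP.<-cmp (toℕ x) (toℕ j)
  ...   | tri< x<j _ _ = enclosing i j x cij cx i<x x<j
  ...   | tri≈ _ x≡j _ = j≢x (FinP.toℕ-injective (sym x≡j))
  ...   | tri> _ _ j<x = crossing i j k y cij cky i<k k<j (ℕP.<-trans j<x x<y)

  via-x-encloses-kept : ∀ {i j k} → k ≢ x → k ≢ y → c i ≡ just x → c y ≡ just j → c k ≡ nothing →
                        i Fin.< k → k Fin.< j → ⊥
  via-x-encloses-kept {i} {j} {k} k≢x k≢y cix cyj ck i<k k<j with ℕP.<-cmp (toℕ x) (toℕ k)
  ... | tri< x<k _ _ = enclosing y j k cyj ck (above-x x<k (toℕ-≢ k≢y)) k<j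
  ... | tri≈ _ x≡k _ = k≢x (FinP.toℕ-injective (sym x≡k))
  ... | tri> _ _ k<x = enclosing i x k cix ck i<k k<x

  via-y-encloses-kept : ∀ {i j k} → k ≢ y → c i ≡ just y → c x ≡ just j → c k ≡ nothing →
                        i Fin.< k → k Fin.< j → ⊥
  via-y-encloses-kept {i} {j} {k} k≢y ciy cxj ck i<k k<j with ℕP.<-cmp (toℕ y) (toℕ k)
  ... | tri< y<k _ _ = enclosing x j k cxj ck (ℕP.<-trans x<y y<k) k<j
  ... | tri≈ _ y≡k _ = k≢y (FinP.toℕ-injective (sym y≡k))
  ... | tri> _ _ k<y = enclosing i y k ciy ck i<k k<y

  g-noEnclosedThrough : ∀ i j k → g i ≡ just j → g k ≡ nothing → i Fin.< k → k Fin.< j → ⊥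
  g-noEnclosedThrough i j k gij gk i<k k<j with glueArc i j gij | glueThrough k gk
  ... | cap-xy refl refl | _ = nothing-between i<k k<j
  ... | cap-yx refl refl | _ = ℕP.<-asym x<y (ℕP.<-trans i<k k<j)
  ... | kept _ _ _ _ cij | kept _ _ ck = enclosing i j k cij ck i<k k<j
  ... | kept _ i≢y j≢x j≢y cij | via-x ckx cy = kept-encloses-via-x i≢y j≢x j≢y cij ckx cy i<k k<j
  ... | kept i≢x i≢y j≢x _ cij | via-y cky cx = kept-encloses-via-y i≢x i≢y j≢x cij cky cx i<k k<j
  ... | via-x cix cyj | kept k≢x k≢y ck = via-x-encloses-kept k≢x k≢y cix cyj ck i<k k<j
  ... | via-y ciy cxj | kept _ k≢y ck = via-y-encloses-kept k≢y ciy cxj ck i<k k<j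
  ... | via-x cix _ | via-x ckx _ = <-≢ i<k (cong toℕ (partner-injective cix ckx))
  ... | via-y ciy _ | via-y cky _ = <-≢ i<k (cong toℕ (partner-injective ciy cky))
  ... | via-x cix _ | via-y _ cx = nothing≢just (trans (sym cx) (symmetric i x cix))
  ... | via-y ciy _ | via-x _ cy = nothing≢just (trans (sym cy) (symmetric i y ciy))

  glue-isHalfDiagram : IsHalfDiagram g
  glue-isHalfDiagram = record
    { symmetric = g-symmetric ; irreflexive = g-irreflexive
    ; noncrossing = g-noncrossing ; noEnclosedThrough = g-noEnclosedThrough }

  -- The cap makes x an opener and y a closer; apart from x, y and
  -- their former partners all steps are unchanged.  In every case the step
  -- sequence of g arises from that of c by a swap (or not at all), which
  -- lowers all heights except possibly the one at y.
  step-g-x : step g x ≡ + 1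
  step-g-x = step-opener g x g-x x<y

  step-g-y : step g y ≡ -1ℤ
  step-g-y = step-closer g y g-y x<y

  step-unchanged : ∀ u → u ≢ x → u ≢ y → c u ≢ just x → c u ≢ just y → step g u ≡ step c u
  step-unchanged u u≢x u≢y u≁x u≁y = step-cong g c u (unchanged (c u) refl)
    where
    unchanged : ∀ m → c u ≡ m → g u ≡ c u
    unchanged nothing cu = trans (g-through u≢x u≢y cu) (sym cu)
    unchanged (just z) cu = trans (g-kept u≢x u≢y cu (λ { refl → u≁x cu }) (λ { refl → u≁y cu })) (sym cu)

  -- Transport agreement of steps along an equality of points (avoids
  -- abstracting the points inside g when splitting cases).
  at : ∀ {u v} → u ≡ v → step g v ≡ step c v → step g u ≡ step c u
  at refl agree = agree

  side : ∀ k → k ≢ x → k ≢ y → toℕ k < toℕ x ⊎ toℕ y < toℕ k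
  side k k≢x k≢y with ℕP.<-cmp (toℕ k) (toℕ x)
  ... | tri< k<x _ _ = inj₁ k<x
  ... | tri≈ _ k≡x _ = ⊥-elim (k≢x (FinP.toℕ-injective k≡x))
  ... | tri> _ _ x<k = inj₂ (above-x x<k (toℕ-≢ k≢y))

  module XPaired {z : Fin n} (cxz : c x ≡ just z) where
    czx : c z ≡ just x
    czx = symmetric x z cxz

    z≢x : z ≢ x
    z≢x refl = irreflexive x cxz

    z≢y : z ≢ y
    z≢y refl = x≁y cxz

    only-z : ∀ {u} → c u ≡ just x → u ≡ z
    only-z cux = partner-injective cux czx

    below-y-through : c y ≡ nothing → BelowExcept g c (toℕ y)
    below-y-through cy with side z z≢x z≢y
    ... | inj₂ y<z = swap-earlier g c y z (swapSteps g c y z (λ e → z≢y (sym e)) others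
                       step-g-y (step-through c y cy) step-g-z (step-closer c z czx (ℕP.<-trans x<y y<z)))
                       y<z (toℕ y)
      where
      step-g-z : step g z ≡ + 1
      step-g-z = step-through g z (trans (g-via-x z≢x z≢y czx) cy)
      others : ∀ u → u ≢ y → u ≢ z → step g u ≡ step c u
      others u u≢y u≢z = case u ≟ x of λ where
        (yes u≡x) → at u≡x (trans step-g-x (sym (step-opener c x cxz (ℕP.<-trans x<y y<z))))
        (no u≢x) → step-unchanged u u≢x u≢y (λ cux → u≢z (only-z cux))
                     (λ cuy → nothing≢just (trans (sym cy) (symmetric u y cuy)))
    ... | inj₁ z<x = swap-adjacent g c y x (swapSteps g c y x (λ e → x≢y (sym e)) others
                       step-g-y (step-through c y cy) step-g-x (step-closer c x cxz z<x))
                       y≡x+1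
      where
      others : ∀ u → u ≢ y → u ≢ x → step g u ≡ step c u
      others u u≢y u≢x = case u ≟ z of λ where
        (yes u≡z) → at u≡z (trans (step-through g z (trans (g-via-x z≢x z≢y czx) cy)) (sym (step-opener c z czx z<x)))
        (no u≢z) → step-unchanged u u≢x u≢y (λ cux → u≢z (only-z cux))
                     (λ cuy → nothing≢just (trans (sym cy) (symmetric u y cuy)))

    module YPaired {w : Fin n} (cyw : c y ≡ just w) where
      cwy : c w ≡ just y
      cwy = symmetric y w cyw

      w≢x : w ≢ x
      w≢x refl = y≁x cyw

      w≢y : w ≢ y
      w≢y refl = irreflexive y cyw

      w≢z : w ≢ z
      w≢z refl = x≢y (just-injective (trans (sym czx) cwy))

      g-z : g z ≡ just w
      g-z = trans (g-via-x z≢x z≢y czx) cyw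

      g-w : g w ≡ just z
      g-w = trans (g-via-y w≢x w≢y cwy) cxz

      unchanged-elsewhere : ∀ u → u ≢ x → u ≢ y → u ≢ z → u ≢ w → step g u ≡ step c u
      unchanged-elsewhere u u≢x u≢y u≢z u≢w =
        step-unchanged u u≢x u≢y (λ cux → u≢z (only-z cux)) (λ cuy → u≢w (partner-injective cuy cwy))

      both-right : toℕ y < toℕ z → toℕ y < toℕ w → BelowExcept g c (toℕ y)
      both-right y<z y<w =
        swap-earlier g c y w (swapSteps g c y w (λ e → w≢y (sym e)) others
          step-g-y (step-opener c y cyw y<w) (step-opener g w g-w w<z) (step-closer c w cwy y<w)) y<w (toℕ y)
        where
        w<z : toℕ w < toℕ z
        w<z with ℕP.<-cmp (toℕ w) (toℕ z)
        ... | tri< w<z _ _ = w<z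
        ... | tri≈ _ w≡z _ = ⊥-elim (w≢z (FinP.toℕ-injective w≡z))
        ... | tri> _ _ z<w = ⊥-elim (crossing x z y w cxz cyw x<y y<z z<w)
        others : ∀ u → u ≢ y → u ≢ w → step g u ≡ step c u
        others u u≢y u≢w = case u ≟ x of λ where
          (yes u≡x) → at u≡x (trans step-g-x (sym (step-opener c x cxz (ℕP.<-trans x<y y<z))))
          (no u≢x) → case u ≟ z of λ where
            (yes u≡z) → at u≡z (trans (step-closer g z g-z w<z) (sym (step-closer c z czx (ℕP.<-trans x<y y<z))))
            (no u≢z) → unchanged-elsewhere u u≢x u≢y u≢z u≢w

      -- w < x < y < z: g pairs w with z and no step changes.
      around : toℕ y < toℕ z → toℕ w < toℕ x → BelowExcept g c (toℕ y)
      around y<z w<x = same-steps g c agree (toℕ y)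
        where
        w<z : toℕ w < toℕ z
        w<z = ℕP.<-trans w<x (ℕP.<-trans x<y y<z)
        agree : ∀ u → step g u ≡ step c u
        agree u = case u ≟ x of λ where
          (yes u≡x) → at u≡x (trans step-g-x (sym (step-opener c x cxz (ℕP.<-trans x<y y<z))))
          (no u≢x) → case u ≟ y of λ where
            (yes u≡y) → at u≡y (trans step-g-y (sym (step-closer c y cyw (ℕP.<-trans w<x x<y))))
            (no u≢y) → case u ≟ z of λ where
              (yes u≡z) → at u≡z (trans (step-closer g z g-z w<z) (sym (step-closer c z czx (ℕP.<-trans x<y y<z))))
              (no u≢z) → case u ≟ w of λ where
                (yes u≡w) → at u≡w (trans (step-opener g w g-w w<z) (sym (step-opener c w cwy (ℕP.<-trans w<x x<y))))
                (no u≢w) → unchanged-elsewhere u u≢x u≢y u≢z u≢w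

      -- z < x < y < w: only the steps at x and y change.
      straddling : toℕ z < toℕ x → toℕ y < toℕ w → BelowExcept g c (toℕ y)
      straddling z<x y<w =
        swap-adjacent g c y x (swapSteps g c y x (λ e → x≢y (sym e)) others
          step-g-y (step-opener c y cyw y<w) step-g-x (step-closer c x cxz z<x)) y≡x+1
        where
        z<w : toℕ z < toℕ w
        z<w = ℕP.<-trans z<x (ℕP.<-trans x<y y<w)
        others : ∀ u → u ≢ y → u ≢ x → step g u ≡ step c u
        others u u≢y u≢x = case u ≟ z of λ where
          (yes u≡z) → at u≡z (trans (step-opener g z g-z z<w) (sym (step-opener c z czx z<x)))
          (no u≢z) → case u ≟ w of λ where
            (yes u≡w) → at u≡w (trans (step-closer g w g-w z<w) (sym (step-closer c w cwy y<w)))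
            (no u≢w) → unchanged-elsewhere u u≢x u≢y u≢z u≢w

      both-left : toℕ z < toℕ x → toℕ w < toℕ x → BelowExcept g c (toℕ y)
      both-left z<x w<x =
        swap-earlier g c z x (swapSteps g c z x z≢x others
          (step-closer g z g-z w<z) (step-opener c z czx z<x) step-g-x (step-closer c x cxz z<x)) z<x (toℕ y)
        where
        w<z : toℕ w < toℕ z
        w<z with ℕP.<-cmp (toℕ w) (toℕ z)
        ... | tri< w<z _ _ = w<z
        ... | tri≈ _ w≡z _ = ⊥-elim (w≢z (FinP.toℕ-injective w≡z))
        ... | tri> _ _ z<w = ⊥-elim (crossing z x w y czx cwy z<w w<x x<y)
        others : ∀ u → u ≢ z → u ≢ x → step g u ≡ step c u
        others u u≢z u≢x = case u ≟ y of λ where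
          (yes u≡y) → at u≡y (trans step-g-y (sym (step-closer c y cyw (ℕP.<-trans w<x x<y))))
          (no u≢y) → case u ≟ w of λ where
            (yes u≡w) → at u≡w (trans (step-opener g w g-w w<z) (sym (step-opener c w cwy (ℕP.<-trans w<x x<y))))
            (no u≢w) → unchanged-elsewhere u u≢x u≢y u≢z u≢w

      below-y-paired : BelowExcept g c (toℕ y)
      below-y-paired with side z z≢x z≢y | side w w≢x w≢y
      ... | inj₂ y<z | inj₂ y<w = both-right y<z y<w
      ... | inj₂ y<z | inj₁ w<x = around y<z w<x
      ... | inj₁ z<x | inj₂ y<w = straddling z<x y<w
      ... | inj₁ z<x | inj₁ w<x = both-left z<x w<x

  module XThrough (cx : c x ≡ nothing) {w : Fin n} (cyw : c y ≡ just w) where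
    cwy : c w ≡ just y
    cwy = symmetric y w cyw

    w≢x : w ≢ x
    w≢x refl = y≁x cyw

    w≢y : w ≢ y
    w≢y refl = irreflexive y cyw

    g-w : g w ≡ nothing
    g-w = trans (g-via-y w≢x w≢y cwy) cx

    unchanged-elsewhere : ∀ u → u ≢ x → u ≢ y → u ≢ w → step g u ≡ step c u
    unchanged-elsewhere u u≢x u≢y u≢w = step-unchanged u u≢x u≢y
      (λ cux → nothing≢just (trans (sym cx) (symmetric u x cux))) (λ cuy → u≢w (partner-injective cuy cwy))

    step-x-unchanged : step g x ≡ step c x
    step-x-unchanged = trans step-g-x (sym (step-through c x cx))

    below-x-through : BelowExcept g c (toℕ y)
    below-x-through with side w w≢x w≢y
    ... | inj₂ y<w =
      swap-earlier g c y w (swapSteps g c y w (λ e → w≢y (sym e)) others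
        step-g-y (step-opener c y cyw y<w) (step-through g w g-w) (step-closer c w cwy y<w)) y<w (toℕ y)
      where
      others : ∀ u → u ≢ y → u ≢ w → step g u ≡ step c u
      others u u≢y u≢w = case u ≟ x of λ where
        (yes u≡x) → at u≡x step-x-unchanged
        (no u≢x) → unchanged-elsewhere u u≢x u≢y u≢w
    ... | inj₁ w<x = same-steps g c agree (toℕ y)
      where
      agree : ∀ u → step g u ≡ step c u
      agree u = case u ≟ x of λ where
        (yes u≡x) → at u≡x step-x-unchanged
        (no u≢x) → case u ≟ y of λ where
          (yes u≡y) → at u≡y (trans step-g-y (sym (step-closer c y cyw (ℕP.<-trans w<x x<y))))
          (no u≢y) → case u ≟ w of λ where
            (yes u≡w) → at u≡w (trans (step-through g w g-w) (sym (step-opener c w cwy (ℕP.<-trans w<x x<y))))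
            (no u≢w) → unchanged-elsewhere u u≢x u≢y u≢w

  glue-below-x-paired : ∀ {z} → c x ≡ just z → BelowExcept g c (toℕ y)
  glue-below-x-paired {z} cxz = byPartnerOfY (c y) refl
    where
    byPartnerOfY : ∀ m → c y ≡ m → BelowExcept g c (toℕ y)
    byPartnerOfY nothing cy = XPaired.below-y-through cxz cy
    byPartnerOfY (just w) cyw = XPaired.YPaired.below-y-paired cxz cyw

  glue-below-x-through : ∀ {w} → c x ≡ nothing → c y ≡ just w → BelowExcept g c (toℕ y)
  glue-below-x-through cx cyw = XThrough.below-x-through cx cyw

-- The basis vectors occurring in e_i ξ_c, where x, y are the points i, i+1:
-- ξ_c itself when x and y are paired (a closed loop), and otherwise the
-- glued diagram (the case of two through-strings gives 0).
data GeneratorTerm {n : ℕ} (x y : Fin n) (c : Raw n) : Raw n → Set where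
  loop            : GeneratorTerm x y c c
  glued-x-paired  : ∀ {z} → c x ≡ just z → z ≢ y → GeneratorTerm x y c (glue x y c)
  glued-x-through : ∀ {w} → c x ≡ nothing → c y ≡ just w → GeneratorTerm x y c (glue x y c)

generatorTerm : ∀ {n} (x y : Fin n) (c : Raw n) {m c'} → actGen x y c ≡ term m c' → GeneratorTerm x y c c'
generatorTerm x y c eq with c x in cx | c y in cy
... | nothing | nothing = case eq of λ ()
... | nothing | just w with eq
...   | refl = glued-x-through cx cy
generatorTerm x y c eq | just z | _ with z ≟ y
...   | yes _ = case eq of λ where refl → loop
...   | no z≢y = case eq of λ where refl → glued-x-paired cx z≢y

⪯-trans : ∀ {n} {c a b : Raw n} → c ⪯ a → a ⪯ b → c ⪯ b
⪯-trans (pc≡pa , c≤a) (pa≡pb , a≤b) = trans pc≡pa pa≡pb , λ j j≤n → ℤP.≤-trans (c≤a j j≤n) (a≤b j j≤n)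

Below : ∀ {n} → ℕ → Raw n → Raw n → Set
Below p a c = IsHalfDiagram c × pairs c ≡ p × c ⪯ a

module BoxAddition {n : ℕ} (i : ℕ) (i+1<n : suc i < n) (a b : Raw n)
                   (hdA : IsHalfDiagram a) (hdB : IsHalfDiagram b)
                   (minimum : HasMinAt a (suc i)) (diamond : IsDiamond (suc i) a b) where
  i<n : i < n
  i<n = ℕP.<-trans (ℕP.n<1+n i) i+1<n

  -- The box is added between the points x and y (paper indices i+1, i+2).
  x y : Fin n
  x = fromℕ< i<n
  y = fromℕ< i+1<n

  y≡x+1 : toℕ y ≡ suc (toℕ x)
  y≡x+1 = trans (FinP.toℕ-fromℕ< i+1<n) (cong suc (sym (FinP.toℕ-fromℕ< i<n)))

  a⪯b : a ⪯ b
  a⪯b = pairs-from-final-height a b (IsHalfDiagram.irreflexive hdA) (IsHalfDiagram.irreflexive hdB)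
          (sym (proj₁ diamond n ℕP.≤-refl (λ n≡i+1 → ℕP.<-irrefl (sym n≡i+1) i+1<n)))
      , a≤b
    where
    a≤b : ∀ j → j ≤ n → h a j ℤ.≤ h b j
    a≤b j j≤n with j ℕ.≟ suc i
    ... | yes refl = subst (h a (suc i) ℤ.≤_) (sym (proj₂ diamond)) (ℤP.i≤i+j (h a (suc i)) (+ 2))
    ... | no j≢i+1 = ℤP.≤-reflexive (sym (proj₁ diamond j j≤n j≢i+1))

  -- At a minimum the point i+1 is a closer, so h_{i+1}(b) = h_i(a) + 1.
  step-a-x : step a x ≡ -1ℤ
  step-a-x with step-±1 a x
  ... | inj₂ down = down
  ... | inj₁ up = ⊥-elim (ℤP.<-irrefl refl (ℤP.<-≤-trans descent (ℤP.i≤i+j (h a i) (+ 1))))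
    where
    descent : h a i ℤ.+ + 1 ℤ.< h a i
    descent = subst (ℤ._< h a i) (trans (height-suc a i i<n) (cong (λ s → h a i ℤ.+ s) up)) (proj₁ minimum)

  height-b : h b (suc i) ≡ h a i ℤ.+ + 1
  height-b = trans (proj₂ diamond) (trans (cong (ℤ._+ + 2) (trans (height-suc a i i<n) (cong (λ s → h a i ℤ.+ s) step-a-x)))
                                          (shift (h a i)))
    where
    shift : ∀ H → (H ℤ.+ -1ℤ) ℤ.+ + 2 ≡ H ℤ.+ + 1
    shift = solve-∀

  -- The glued diagram lies below b: away from y it is below c ⪯ a ⪯ b, and
  -- at y its height is h_i(g) + 1 ≤ h_i(a) + 1 = h_{i+1}(b).
  glued-below : ∀ {c} (hdC : IsHalfDiagram c) (x≁y : c x ≢ just y) → c ⪯ a →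
                BelowExcept (glue x y c) c (toℕ y) → glue x y c ⪯ b
  glued-below {c} hdC x≁y (pc≡pa , c≤a) g≤c =
    trans (pairs-from-final-height g c (IsHalfDiagram.irreflexive hdG) (IsHalfDiagram.irreflexive hdC)
             (BelowExcept.final g≤c))
          (trans pc≡pa (proj₁ a⪯b)) ,
    g≤b
    where
    open Gluing x y y≡x+1 c hdC x≁y using (g; step-g-x) renaming (glue-isHalfDiagram to hdG)
    i≢y : i ≢ toℕ y
    i≢y i≡y = ℕP.<-irrefl (trans i≡y (FinP.toℕ-fromℕ< i+1<n)) (ℕP.n<1+n i)
    g≤b : ∀ j → j ≤ n → h g j ℤ.≤ h b j
    g≤b j j≤n with j ℕ.≟ suc i
    ... | yes refl = begin
      h g (suc i)          ≡⟨ trans (height-suc g i i<n) (cong (λ s → h g i ℤ.+ s) step-g-x) ⟩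
      h g i ℤ.+ + 1        ≤⟨ ℤP.+-monoˡ-≤ (+ 1) (ℤP.≤-trans (BelowExcept.below g≤c i i≢y) (c≤a i (ℕP.<⇒≤ i<n))) ⟩
      h a i ℤ.+ + 1        ≡⟨ sym height-b ⟩
      h b (suc i)          ∎
      where open ℤP.≤-Reasoning
    ... | no j≢i+1 = ℤP.≤-trans (BelowExcept.below g≤c j (λ j≡y → j≢i+1 (trans j≡y (FinP.toℕ-fromℕ< i+1<n))))
                       (ℤP.≤-trans (c≤a j j≤n) (proj₂ a⪯b j j≤n))

  glued-Below : ∀ {p c} → Below p a c → (x≁y : c x ≢ just y) → BelowExcept (glue x y c) c (toℕ y) →
                Below p b (glue x y c)
  glued-Below {c = c} (hdC , pc , c⪯a) x≁y g≤c =
    Gluing.glue-isHalfDiagram x y y≡x+1 c hdC x≁y ,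
    trans (proj₁ g⪯b) (trans (sym (proj₁ a⪯b)) (trans (sym (proj₁ c⪯a)) pc)) ,
    g⪯b
    where
    g⪯b : glue x y c ⪯ b
    g⪯b = glued-below hdC x≁y c⪯a g≤c

  term-below : ∀ {p c c'} → Below p a c → GeneratorTerm x y c c' → Below p b c'
  term-below (hdC , pc , c⪯a) loop = hdC , pc , ⪯-trans c⪯a a⪯b
  term-below {c = c} below-c@(hdC , _) (glued-x-paired cxz z≢y) =
    glued-Below below-c x≁y (Gluing.glue-below-x-paired x y y≡x+1 c hdC x≁y cxz)
    where
    x≁y : c x ≢ just y
    x≁y cxy = z≢y (just-injective (trans (sym cxz) cxy))
  term-below {c = c} below-c@(hdC , _) (glued-x-through cx cyw) =
    glued-Below below-c x≁y (Gluing.glue-below-x-through x y y≡x+1 c hdC x≁y cx cyw)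
    where
    x≁y : c x ≢ just y
    x≁y cxy = nothing≢just (trans (sym cx) cxy)

module _ {c ℓ} (R : CommutativeRing c ℓ) where
  open CommutativeRing R using (Carrier)

  actU-preserves : ∀ {n} (q : Carrier) (x y : Fin n) (P Q : Raw n → Set) →
                   (∀ {c c'} → P c → GeneratorTerm x y c c' → Q c') →
                   ∀ v → All (λ kc → P (proj₂ kc)) v → All (λ kc → Q (proj₂ kc)) (actU R q x y v)
  actU-preserves q x y P Q terms [] [] = []
  actU-preserves q x y P Q terms ((k , c) ∷ v) (pc ∷ pv) with actGen x y c in eq
  ... | zeroV = actU-preserves q x y P Q terms v pv
  ... | term m c' = terms pc (generatorTerm x y c eq) ∷ actU-preserves q x y P Q terms v pv

  scale-preserves : ∀ {n} (s : Carrier) (P : Raw n → Set) →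
                    ∀ v → All (λ kc → P (proj₂ kc)) v → All (λ kc → P (proj₂ kc)) (scale R s v)
  scale-preserves s P [] [] = []
  scale-preserves s P ((k , c) ∷ v) (pc ∷ pv) = pc ∷ scale-preserves s P v pv

  reach-invariant : ∀ {n p q inv a v} → 2 * p ≤ n → Reach R q inv n p a v →
                    IsHalfDiagram a × pairs a ≡ p × All (λ kc → Below p a (proj₂ kc)) v
  reach-invariant {n} {p} 2p≤n start =
    hdMin , minDiag-pairs p 2p≤n , (hdMin , minDiag-pairs p 2p≤n , refl , λ _ _ → ℤP.≤-refl) ∷ []
    where
    hdMin : IsHalfDiagram (minDiag {n} p)
    hdMin = minDiag-isHalfDiagram p
  reach-invariant {p = p} {q} 2p≤n (box {a} {v} i i+1<n b reach minimum hdB diamond)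
    with reach-invariant 2p≤n reach
  ... | hdA , pa , below-a =
    hdB , trans (sym (proj₁ a⪯b)) pa ,
    ++⁺ (actU-preserves q x y (Below p a) (Below p b) term-below v below-a)
        (scale-preserves _ (Below p b) v (All.map (λ { (hdC , pc , c⪯a) → hdC , pc , ⪯-trans c⪯a a⪯b }) below-a))
    where open BoxAddition i i+1<n a b hdA hdB minimum diamond

-- The list representing ξ'_a is itself the required combination: all its
-- basis vectors are half-diagrams with p pairs below a.
mainTheorem2 : ∀ {c ℓ} (R : CommutativeRing c ℓ) (n p : ℕ) → 2 * p ≤ n →
    (q : CommutativeRing.Carrier R) (inv : ℕ → CommutativeRing.Carrier R) →
    (∀ k → k ≤ n → CommutativeRing._≈_ R (CommutativeRing._*_ R (inv k) (Δ R q k)) (CommutativeRing.1# R)) →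
    ∀ (a : Raw n) (v : U R n) → Reach R q inv n p a v → InSpanBelow R p a v
mainTheorem2 R n p 2p≤n q inv _ a v reach =
  v , proj₂ (proj₂ (reach-invariant R 2p≤n reach)) , λ _ → CommutativeRing.refl R
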